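{- Let $n \ge 4$ and let $r \in \{1, \ldots, n-3\}$. The permutation $K_{r,n}$ can be transformed into $K_{r+1,n}$ by a sequence of $3r-2$ LRE moves, namely $L^{r-1}$, then $E$, then $(RE)^{r-1}$.
   Context: Permutations of $\{1,\ldots,n\}$ are written as sequences $(a_1,\ldots,a_n)$. The LRE moves are: $L$ (left rotate), $(a_1,\ldots,a_n)\mapsto(a_2,\ldots,a_n,a_1)$; $R$ (right rotate), $(a_1,\ldots,a_n)\mapsto(a_n,a_1,\ldots,a_{n-1})$; $E$ (exchange), $(a_1,a_2,a_3,\ldots,a_n)\mapsto(a_2,a_1,a_3,\ldots,a_n)$. Moves are applied one after another in the order written. $X^p$ denotes $p$ consecutive applications of move $X$. $RE$ denotes an $R$ move followed by an $E$ move, and $(RE)^p$ denotes $p$ consecutive repetitions of $RE$ (so $2p$ moves). For $1\le r\le n$, $K_{r,n}$ is the permutation $(n-r+1, n-r+2, \ldots, n, n-r, n-r-1, \ldots, 2, 1)$, i.e. the largest $r$ values in increasing order followed by the remaining values in decreasing order. -}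

module Defs where

open import Data.Nat using (ℕ; zero; suc; _+_; _∸_)
open import Data.List using (List; []; _∷_; _++_; reverse; applyUpTo; replicate; concat; foldl)

-- A permutation of {1..n} written as the sequence (a₁,…,aₙ).
Seq : Set
Seq = List ℕ

data Move : Set where
  L R E : Move

left : Seq → Seq
left []       = []
left (a ∷ as) = as ++ (a ∷ [])

right : Seq → Seq
right s = reverse (left (reverse s))

exch : Seq → Seq
exch (a ∷ b ∷ as) = b ∷ a ∷ as
exch s            = s

apply : Move → Seq → Seq
apply L = left
apply R = right
apply E = exch

-- Moves applied one after another, in the order written (left to right).
applyAll : List Move → Seq → Seq
applyAll ms s = foldl (λ t m → apply m t) s ms

pow : ℕ → List Move → List Move
pow p ms = concat (replicate p ms)

-- K_{r,n} = (n-r+1, …, n, n-r, n-r-1, …, 1)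
K : ℕ → ℕ → Seq
K r n = applyUpTo (λ i → (n ∸ r) + suc i) r ++ reverse (applyUpTo suc (n ∸ r))

-- Write K_{r,n} as ys ++ t ∷ a ∷ ds, where ys are the r−1 smallest of the r largest values, t = n,
-- a = n − r and ds is the decreasing tail. Then L^{r−1} rotates ys to the back, E swaps t and a, and
-- each RE takes the last entry of ys and slips it in just behind a, so (RE)^{r−1} restores ys in order
-- behind a, giving a ∷ ys ++ t ∷ ds = K_{r+1,n}.
module Submission where

open import Defs
open import Data.Nat using (ℕ; zero; suc; s≤s; _≤_; _∸_; _*_; _+_)
open import Data.Nat.Properties using (+-suc; +-comm; *-suc; +-∸-assoc; m≤n⇒m≤1+n)
open import Data.Nat.Tactic.RingSolver using (solve-∀)
open import Data.List using (List; []; _∷_; _++_; _∷ʳ_; length; reverse; applyUpTo)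
open import Data.List.Properties
  using (foldl-++; ++-assoc; ++-identityʳ; reverse-++; reverse-involutive; length-++; length-applyUpTo; applyUpTo-∷ʳ)
open import Data.List.Reverse using (Reverse; []; _∶_∶ʳ_; reverseView)
open import Data.Product using (_×_; _,_)
open import Function using (_∘_)
open import Relation.Binary.PropositionalEquality using (_≡_; _≗_; refl; sym; trans; cong; cong₂; module ≡-Reasoning)

open ≡-Reasoning

applyAll-++ : ∀ ms ms′ s → applyAll (ms ++ ms′) s ≡ applyAll ms′ (applyAll ms s)
applyAll-++ ms ms′ s = foldl-++ (λ t m → apply m t) s ms ms′

length-pow : ∀ k (ms : List Move) → length (pow k ms) ≡ k * length ms
length-pow zero    ms = refl
length-pow (suc k) ms = trans (length-++ ms) (cong (length ms +_) (length-pow k ms))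

right-∷ʳ : ∀ (xs : Seq) x → right (xs ∷ʳ x) ≡ x ∷ xs
right-∷ʳ xs x = begin
  reverse (left (reverse (xs ∷ʳ x)))           ≡⟨ cong (reverse ∘ left) (reverse-++ xs (x ∷ [])) ⟩
  reverse (reverse xs ∷ʳ x)                     ≡⟨ reverse-++ (reverse xs) (x ∷ []) ⟩
  x ∷ reverse (reverse xs)                      ≡⟨ cong (x ∷_) (reverse-involutive xs) ⟩
  x ∷ xs                                        ∎

left-pow : ∀ (xs ys : Seq) → applyAll (pow (length xs) (L ∷ [])) (xs ++ ys) ≡ ys ++ xs
left-pow []       ys = sym (++-identityʳ ys)
left-pow (x ∷ xs) ys = begin
  applyAll (pow (length xs) (L ∷ [])) ((xs ++ ys) ∷ʳ x) ≡⟨ cong (applyAll (pow (length xs) (L ∷ []))) (++-assoc xs ys (x ∷ [])) ⟩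
  applyAll (pow (length xs) (L ∷ [])) (xs ++ ys ∷ʳ x)   ≡⟨ left-pow xs (ys ∷ʳ x) ⟩
  (ys ∷ʳ x) ++ xs                                       ≡⟨ ++-assoc ys (x ∷ []) xs ⟩
  ys ++ x ∷ xs                                          ∎

rightExch-pow : ∀ a (xs ys : Seq) → applyAll (pow (length ys) (R ∷ E ∷ [])) (a ∷ xs ++ ys) ≡ a ∷ ys ++ xs
rightExch-pow a xs ys = go xs (reverseView ys)
  where
  go : ∀ xs {ys} → Reverse ys → applyAll (pow (length ys) (R ∷ E ∷ [])) (a ∷ xs ++ ys) ≡ a ∷ ys ++ xs
  go xs [] = cong (a ∷_) (++-identityʳ xs)
  go xs (zs ∶ rs ∶ʳ z) = begin
    applyAll (pow (length (zs ∷ʳ z)) RE) (a ∷ xs ++ zs ∷ʳ z)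
      ≡⟨ cong (λ k → applyAll (pow k RE) (a ∷ xs ++ zs ∷ʳ z)) (trans (length-++ zs) (+-comm (length zs) 1)) ⟩
    applyAll (pow (length zs) RE) (exch (right (a ∷ xs ++ zs ∷ʳ z)))
      ≡⟨ cong (applyAll (pow (length zs) RE) ∘ exch ∘ right ∘ (a ∷_)) (sym (++-assoc xs zs (z ∷ []))) ⟩
    applyAll (pow (length zs) RE) (exch (right ((a ∷ xs ++ zs) ∷ʳ z)))
      ≡⟨ cong (applyAll (pow (length zs) RE) ∘ exch) (right-∷ʳ (a ∷ xs ++ zs) z) ⟩
    applyAll (pow (length zs) RE) (a ∷ (z ∷ xs) ++ zs)
      ≡⟨ go (z ∷ xs) rs ⟩
    a ∷ zs ++ z ∷ xs
      ≡⟨ cong (a ∷_) (sym (++-assoc zs (z ∷ []) xs)) ⟩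
    a ∷ (zs ∷ʳ z) ++ xs ∎
    where RE = R ∷ E ∷ []

bringForward : ℕ → List Move
bringForward k = pow k (L ∷ []) ++ E ∷ pow k (R ∷ E ∷ [])

length-bringForward : ∀ k → length (bringForward k) ≡ 3 * suc k ∸ 2
length-bringForward k = begin
  length (bringForward k)
    ≡⟨ length-++ (pow k (L ∷ [])) ⟩
  length (pow k (L ∷ [])) + suc (length (pow k (R ∷ E ∷ [])))
    ≡⟨ cong₂ (λ p q → p + suc q) (length-pow k (L ∷ [])) (length-pow k (R ∷ E ∷ [])) ⟩
  k * 1 + suc (k * 2)
    ≡⟨ arithmetic k ⟩
  suc (3 * k)
    ≡⟨ cong (_∸ 2) (sym (*-suc 3 k)) ⟩
  3 * suc k ∸ 2 ∎
  where
  arithmetic : ∀ k → k * 1 + suc (k * 2) ≡ suc (3 * k)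
  arithmetic = solve-∀

applyAll-bringForward : ∀ (ys : Seq) t a ds →
  applyAll (bringForward (length ys)) (ys ++ t ∷ a ∷ ds) ≡ a ∷ ys ++ t ∷ ds
applyAll-bringForward ys t a ds = begin
  applyAll (bringForward k) (ys ++ t ∷ a ∷ ds)
    ≡⟨ applyAll-++ (pow k (L ∷ [])) (E ∷ pow k (R ∷ E ∷ [])) (ys ++ t ∷ a ∷ ds) ⟩
  applyAll (E ∷ pow k (R ∷ E ∷ [])) (applyAll (pow k (L ∷ [])) (ys ++ t ∷ a ∷ ds))
    ≡⟨ cong (applyAll (E ∷ pow k (R ∷ E ∷ []))) (left-pow ys (t ∷ a ∷ ds)) ⟩
  applyAll (pow k (R ∷ E ∷ [])) (a ∷ (t ∷ ds) ++ ys)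
    ≡⟨ rightExch-pow a (t ∷ ds) ys ⟩
  a ∷ ys ++ t ∷ ds ∎
  where k = length ys

ascending : ℕ → ℕ → Seq
ascending m r = applyUpTo (λ i → m + suc i) r

descending : ℕ → Seq
descending m = reverse (applyUpTo suc m)

-- K r n is K′ (n ∸ r) r by definition.
K′ : ℕ → ℕ → Seq
K′ m r = ascending m r ++ descending m

applyUpTo-cong : ∀ {A : Set} {f g : ℕ → A} → f ≗ g → ∀ r → applyUpTo f r ≡ applyUpTo g r
applyUpTo-cong f≗g zero    = refl
applyUpTo-cong f≗g (suc r) = cong₂ _∷_ (f≗g 0) (applyUpTo-cong (f≗g ∘ suc) r)

ascending-suc : ∀ m r → ascending m (suc r) ≡ suc m ∷ ascending (suc m) r
ascending-suc m r = cong₂ _∷_ (+-comm m 1) (applyUpTo-cong (λ i → +-suc m (suc i)) r)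

descending-suc : ∀ m → descending (suc m) ≡ suc m ∷ descending m
descending-suc m = trans (cong reverse (sym (applyUpTo-∷ʳ suc m))) (reverse-++ (applyUpTo suc m) (suc m ∷ []))

K′-split : ∀ m k → K′ (suc m) (suc k) ≡ ascending (suc m) k ++ suc m + suc k ∷ suc m ∷ descending m
K′-split m k = begin
  ascending (suc m) (suc k) ++ descending (suc m)
    ≡⟨ cong₂ _++_ (sym (applyUpTo-∷ʳ _ k)) (descending-suc m) ⟩
  (ascending (suc m) k ∷ʳ (suc m + suc k)) ++ suc m ∷ descending m
    ≡⟨ ++-assoc (ascending (suc m) k) _ _ ⟩
  ascending (suc m) k ++ suc m + suc k ∷ suc m ∷ descending m ∎

K′-merge : ∀ m k → suc m ∷ ascending (suc m) k ++ suc m + suc k ∷ descending m ≡ K′ m (suc (suc k))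
K′-merge m k = begin
  suc m ∷ ascending (suc m) k ++ suc m + suc k ∷ descending m
    ≡⟨ cong (suc m ∷_) (sym (++-assoc (ascending (suc m) k) _ _)) ⟩
  suc m ∷ (ascending (suc m) k ∷ʳ (suc m + suc k)) ++ descending m
    ≡⟨ cong (λ xs → suc m ∷ xs ++ descending m) (applyUpTo-∷ʳ _ k) ⟩
  suc m ∷ ascending (suc m) (suc k) ++ descending m
    ≡⟨ cong (_++ descending m) (sym (ascending-suc m (suc k))) ⟩
  K′ m (suc (suc k)) ∎

applyAll-bringForward-K′ : ∀ m k → applyAll (bringForward k) (K′ (suc m) (suc k)) ≡ K′ m (suc (suc k))
applyAll-bringForward-K′ m k = begin
  applyAll (bringForward k) (K′ (suc m) (suc k))
    ≡⟨ cong (applyAll (bringForward k)) (K′-split m k) ⟩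
  applyAll (bringForward k) (ys ++ suc m + suc k ∷ suc m ∷ descending m)
    ≡⟨ cong (λ j → applyAll (bringForward j) (ys ++ suc m + suc k ∷ suc m ∷ descending m)) (sym (length-applyUpTo _ k)) ⟩
  applyAll (bringForward (length ys)) (ys ++ suc m + suc k ∷ suc m ∷ descending m)
    ≡⟨ applyAll-bringForward ys (suc m + suc k) (suc m) (descending m) ⟩
  suc m ∷ ys ++ suc m + suc k ∷ descending m
    ≡⟨ K′-merge m k ⟩
  K′ m (suc (suc k)) ∎
  where ys = ascending (suc m) k

lemma1 : (n r : ℕ) → 4 ≤ n → 1 ≤ r → r ≤ n ∸ 3 →
    (length (pow (r ∸ 1) (L ∷ []) ++ E ∷ [] ++ pow (r ∸ 1) (R ∷ E ∷ [])) ≡ 3 * r ∸ 2)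
    × (applyAll (pow (r ∸ 1) (L ∷ []) ++ E ∷ [] ++ pow (r ∸ 1) (R ∷ E ∷ [])) (K r n) ≡ K (suc r) n)
lemma1 (suc (suc (suc n′))) (suc k) _ _ k<n′ = length-bringForward k , moves-K
  where
  n = suc (suc (suc n′))
  n∸[1+k]≡1+n∸[2+k] : n ∸ suc k ≡ suc (n ∸ suc (suc k))
  n∸[1+k]≡1+n∸[2+k] = +-∸-assoc 1 {n} (s≤s (m≤n⇒m≤1+n (m≤n⇒m≤1+n k<n′)))
  moves-K : applyAll (bringForward k) (K′ (n ∸ suc k) (suc k)) ≡ K′ (n ∸ suc (suc k)) (suc (suc k))
  moves-K = trans (cong (λ m → applyAll (bringForward k) (K′ m (suc k))) n∸[1+k]≡1+n∸[2+k])
                  (applyAll-bringForward-K′ (n ∸ suc (suc k)) k)
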